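{- For every integer $k\ge 1$, the cycle $C_{4k}$ admits a $2$-graceful $\alpha$-labeling.
   Context: $C_n$ denotes the cycle on $n$ vertices (with $n$ edges). For a graph $\Gamma$ of size $e$ and a divisor $d$ of $e$ with $e=d\cdot m$, a $d$-graceful labeling of $\Gamma$ is an injective function $f:V(\Gamma)\to\{0,1,\ldots,d(m+1)-1\}$ such that $\{|f(x)-f(y)| : [x,y]\in E(\Gamma)\}=\{1,2,\ldots,d(m+1)-1\}\setminus\{m+1,2(m+1),\ldots,(d-1)(m+1)\}$. If $\Gamma$ is bipartite with parts $X,Y$, a $d$-graceful $\alpha$-labeling is a $d$-graceful labeling $f$ such that $\max f(X)<\min f(Y)$ for a suitable ordering of the two parts. -}

module Defs where

open import Data.Nat using (ℕ; zero; suc; _+_; _*_; _<_; ∣_-_∣)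
open import Data.Nat.Divisibility using (_∣_)
open import Data.Nat.DivMod using (_%_; m%n<n)
open import Data.Fin using (Fin; toℕ; fromℕ<)
open import Data.List using (List; map; length; allFin)
open import Data.List.Membership.Propositional using (_∈_)
open import Data.Product using (Σ; _×_; _,_; ∃-syntax)
open import Data.Bool using (Bool; true; false)
open import Relation.Nullary using (¬_)
open import Relation.Binary.PropositionalEquality using (_≡_; _≢_)
open import Function.Definitions using (Injective)

-- A finite (multi)graph: vertex set Fin nV, edges listed as unordered pairs [x , y].
record Graph : Set where
  field
    nV    : ℕ
    edges : List (Fin nV × Fin nV)
open Graph public

size : Graph → ℕ
size Γ = length (edges Γ)

next : ∀ {n} → Fin n → Fin n
next {suc n} i = fromℕ< (m%n<n (suc (toℕ i)) (suc n))

Cycle : ℕ → Graph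
Cycle n = record { nV = n ; edges = map (λ i → (i , next i)) (allFin n) }

-- the admissible edge labels {1,...,d(m+1)-1} \ {m+1, 2(m+1), ..., (d-1)(m+1)}
Allowed : ℕ → ℕ → ℕ → Set
Allowed d m t = t < d * suc m × ¬ (suc m ∣ t)

IsDGraceful : (d : ℕ) → (Γ : Graph) → (Fin (nV Γ) → ℕ) → Set
IsDGraceful d Γ f =
  Σ ℕ λ m →
    (size Γ ≡ d * m)
  × Injective _≡_ _≡_ f
  × (∀ x → f x < d * suc m)
  × (∀ {x y} → (x , y) ∈ edges Γ → Allowed d m ∣ f x - f y ∣)
  × (∀ t → Allowed d m t → ∃[ x ] ∃[ y ] ((x , y) ∈ edges Γ × ∣ f x - f y ∣ ≡ t))

-- c : Fin nV → Bool is a bipartition of Γ (X = c⁻¹ false, Y = c⁻¹ true)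
IsBipartition : (Γ : Graph) → (Fin (nV Γ) → Bool) → Set
IsBipartition Γ c = ∀ {x y} → (x , y) ∈ edges Γ → c x ≢ c y

-- d-graceful α-labeling: d-graceful and max f(X) < min f(Y) for a bipartition (X , Y)
IsDGracefulα : (d : ℕ) → (Γ : Graph) → (Fin (nV Γ) → ℕ) → Set
IsDGracefulα d Γ f =
  IsDGraceful d Γ f ×
  ∃[ c ] (IsBipartition Γ c × (∀ x y → c x ≡ false → c y ≡ true → f x < f y))

module Submission where

open import Defs
open import Data.Nat using (ℕ; _≤_; _*_)
open import Data.Fin using (Fin)
open import Data.Product using (∃-syntax)

open import Data.Nat using (zero; suc; _+_; _∸_; _<_; z≤n; s≤s; z<s; ∣_-_∣; _<?_)
open import Data.Nat.Properties
open import Data.Nat.Divisibility using (_∣_; divides; _∣0; ∣-refl)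
open import Data.Nat.DivMod using (_%_; m<n⇒m%n≡m; n%n≡0)
open import Data.Nat.Tactic.RingSolver using (solve-∀)
open import Data.Fin using (toℕ; fromℕ<)
open import Data.Fin.Properties using (toℕ-fromℕ<; toℕ-injective; toℕ<n)
open import Data.List using (allFin)
open import Data.List.Properties using (length-map; length-tabulate)
open import Data.List.Membership.Propositional using (_∈_)
open import Data.List.Membership.Propositional.Properties using (∈-map⁺; ∈-map⁻; ∈-allFin)
open import Data.Product using (_×_; _,_; proj₂; map₁)
open import Data.Sum using (_⊎_; inj₁; inj₂)
open import Data.Bool using (Bool; true; false)
open import Relation.Nullary using (¬_; yes; no; contradiction)
open import Relation.Binary using (tri<; tri≈; tri>)
open import Relation.Binary.PropositionalEquality
open import Function using (_∘_)

-- Let k ≥ 1; C_{4k} has 4k edges, so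
-- m = 2k and labels lie in {0,…,4k+1}, the only forbidden edge length being 2k+1.
-- Label vertex 2j by  lower j  (0 if j = 0, 2k − j otherwise) and vertex 2j+1 by
-- upper j = gap j + 2k + j, where gap j is 0 for j < k and 2 for j ≥ k.
--   * Even vertices carry labels < 2k, odd vertices labels ≥ 2k: colouring by parity
--     is a bipartition witnessing the α-condition, and injectivity reduces to the
--     injectivity of lower and upper separately.
--   * Read as a function on ℕ the labeling is 4k-periodic (lower (2k) = 0), so every
--     edge of the cycle, the closing one included, joins positions i and i+1.
--   * The edge starting at position i has length 2k for i = 0, i for 0 < i < 2k and
--     i + 2 for 2k ≤ i < 4k, which enumerates {1,…,4k+1} ∖ {2k+1} exactly: for d = 2
--     this is the admissible set.

-- Distances given additively, avoiding truncated subtraction.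
dist-grow : ∀ {a b t} → b ≡ a + t → ∣ a - b ∣ ≡ t
dist-grow {a} {t = t} refl = ∣m-m+n∣≡n a t

dist-shrink : ∀ {a b t} → a ≡ b + t → ∣ a - b ∣ ≡ t
dist-shrink {a} {b} eq = trans (∣-∣-comm a b) (dist-grow eq)

half-< : ∀ {a b} → 2 * a < 2 * b → a < b
half-< {a} {b} = *-cancelˡ-< 2 a b

half-≤ : ∀ {a b} → 2 * a ≤ 2 * b → a ≤ b
half-≤ = *-cancelˡ-≤ 2

odd-< : ∀ {a b} → suc (2 * a) < 2 * b → a < b
odd-< lt = half-< (<-trans (n<1+n _) lt)

odd-≤ : ∀ {a b} → 2 * a ≤ suc (2 * b) → a ≤ b
odd-≤ {a} {b} le = ≮⇒≥ λ b<a →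
  1+n≰n (≤-trans (≤-trans (≤-reflexive (sym (*-suc 2 b))) (*-monoʳ-≤ 2 b<a)) le)

data EvenOdd : ℕ → Set where
  even : ∀ j → EvenOdd (2 * j)
  odd  : ∀ j → EvenOdd (suc (2 * j))

evenOdd : ∀ n → EvenOdd n
evenOdd zero = even 0
evenOdd (suc zero) = odd 0
evenOdd (suc (suc n)) with evenOdd n
... | even j = subst EvenOdd (*-suc 2 j) (even (suc j))
... | odd j  = subst EvenOdd (cong suc (*-suc 2 j)) (odd (suc j))

half : ℕ → ℕ × Bool
half zero = (0 , false)
half (suc zero) = (0 , true)
half (suc (suc n)) = map₁ suc (half n)

half-even : ∀ j → half (2 * j) ≡ (j , false)
half-even zero = refl
half-even (suc j) = begin
  half (2 * suc j)         ≡⟨ cong half (*-suc 2 j) ⟩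
  map₁ suc (half (2 * j))  ≡⟨ cong (map₁ suc) (half-even j) ⟩
  (suc j , false)          ∎
  where open ≡-Reasoning

half-odd : ∀ j → half (suc (2 * j)) ≡ (j , true)
half-odd zero = refl
half-odd (suc j) = begin
  half (suc (2 * suc j))         ≡⟨ cong (half ∘ suc) (*-suc 2 j) ⟩
  map₁ suc (half (suc (2 * j)))  ≡⟨ cong (map₁ suc) (half-odd j) ⟩
  (suc j , true)                 ∎
  where open ≡-Reasoning

-- For t < 2(m+1), being a multiple of m+1 means t = 0 or t = m+1.
allowed₂ : ∀ {m t} → t < 2 * suc m → t ≢ 0 → t ≢ suc m → Allowed 2 m t
allowed₂ {m} {t} t<2M t≢0 t≢M = t<2M , not-multiple
  where
  not-multiple : ¬ (suc m ∣ t)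
  not-multiple (divides zero eq) = t≢0 eq
  not-multiple (divides (suc zero) eq) = t≢M (trans eq (+-identityʳ (suc m)))
  not-multiple (divides (suc (suc q)) eq) =
    <⇒≱ t<2M (subst (2 * suc m ≤_) (sym eq) (+-monoʳ-≤ (suc m) (+-monoʳ-≤ (suc m) z≤n)))

allowed₂⁻ : ∀ {m t} → Allowed 2 m t → t ≢ 0 × t ≢ suc m
allowed₂⁻ {m} (_ , not-multiple) =
  (λ { refl → not-multiple (suc m ∣0) }) , (λ { refl → not-multiple ∣-refl })

edgeLength : (ℕ → ℕ) → ℕ → ℕ
edgeLength g i = ∣ g i - g (suc i) ∣

size-Cycle : ∀ n → size (Cycle n) ≡ n
size-Cycle n = trans (length-map _ (allFin n)) (length-tabulate (λ i → i))

∈-Cycle⁺ : ∀ {n} (i : Fin n) → (i , next i) ∈ edges (Cycle n)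
∈-Cycle⁺ i = ∈-map⁺ _ (∈-allFin i)

∈-Cycle⁻ : ∀ {n} {x y : Fin n} → (x , y) ∈ edges (Cycle n) → y ≡ next x
∈-Cycle⁻ e with ∈-map⁻ _ e
... | _ , _ , refl = refl

toℕ-next : ∀ {n} (i : Fin n) → toℕ (next i) ≡ suc (toℕ i) ⊎ (toℕ (next i) ≡ 0 × suc (toℕ i) ≡ n)
toℕ-next {suc n} i with m≤n⇒m<n∨m≡n (toℕ<n i)
... | inj₁ lt = inj₁ (trans (toℕ-fromℕ< _) (m<n⇒m%n≡m lt))
... | inj₂ eq = inj₂ (trans (toℕ-fromℕ< _) (trans (cong (_% suc n) eq) (n%n≡0 (suc n))) , eq)

periodic-next : ∀ {A : Set} {n} (h : ℕ → A) → h n ≡ h 0 → (i : Fin n) → h (toℕ (next i)) ≡ h (suc (toℕ i))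
periodic-next h period i with toℕ-next i
... | inj₁ eq = cong h eq
... | inj₂ (eq , last) = trans (cong h eq) (trans (sym period) (cong h (sym last)))

cycle-edgeLength : ∀ {n} (g : ℕ → ℕ) → g n ≡ g 0 → (i : Fin n) →
                   ∣ g (toℕ i) - g (toℕ (next i)) ∣ ≡ edgeLength g (toℕ i)
cycle-edgeLength g period i = cong (∣ g (toℕ i) -_∣) (periodic-next g period i)

cycle-dGraceful : ∀ {d m n} (g : ℕ → ℕ) → n ≡ d * m → g n ≡ g 0 →
  (∀ {i j} → i < n → j < n → g i ≡ g j → i ≡ j) →
  (∀ {i} → i < n → g i < d * suc m) →
  (∀ {i} → i < n → Allowed d m (edgeLength g i)) →
  (∀ {t} → Allowed d m t → ∃[ i ] (i < n × edgeLength g i ≡ t)) →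
  IsDGraceful d (Cycle n) (λ x → g (toℕ x))
cycle-dGraceful {d} {m} {n} g n≡dm period injective range allowed onto =
  m , trans (size-Cycle n) n≡dm
    , (λ eq → toℕ-injective (injective (toℕ<n _) (toℕ<n _) eq))
    , (λ x → range (toℕ<n x))
    , edge-allowed
    , edge-onto
  where
  edge-allowed : ∀ {x y} → (x , y) ∈ edges (Cycle n) → Allowed d m ∣ g (toℕ x) - g (toℕ y) ∣
  edge-allowed {x} e rewrite ∈-Cycle⁻ e =
    subst (Allowed d m) (sym (cycle-edgeLength g period x)) (allowed (toℕ<n x))

  edge-onto : ∀ t → Allowed d m t →
              ∃[ x ] ∃[ y ] ((x , y) ∈ edges (Cycle n) × ∣ g (toℕ x) - g (toℕ y) ∣ ≡ t)
  edge-onto t adm with onto adm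
  ... | i , i<n , len≡t = x , next x , ∈-Cycle⁺ x , trans (cycle-edgeLength g period x) len≡x
    where
    x : Fin n
    x = fromℕ< i<n
    len≡x : edgeLength g (toℕ x) ≡ t
    len≡x = trans (cong (edgeLength g) (toℕ-fromℕ< i<n)) len≡t

cycle-α : ∀ {n} (g : ℕ → ℕ) (c : ℕ → Bool) → c n ≡ c 0 →
  (∀ {i} → i < n → c i ≢ c (suc i)) →
  (∀ {i j} → i < n → c i ≡ false → c j ≡ true → g i < g j) →
  ∃[ col ] (IsBipartition (Cycle n) col ×
            (∀ x y → col x ≡ false → col y ≡ true → g (toℕ x) < g (toℕ y)))
cycle-α {n} g c period alternating separated =
  (λ x → c (toℕ x)) , bipartite , (λ x y → separated (toℕ<n x))
  where
  bipartite : IsBipartition (Cycle n) (λ x → c (toℕ x))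
  bipartite {x} e rewrite ∈-Cycle⁻ e =
    subst (c (toℕ x) ≢_) (sym (periodic-next c period x)) (alternating (toℕ<n x))

module Construction (k : ℕ) (k>0 : 0 < k) where

  lower : ℕ → ℕ
  lower zero = zero
  lower (suc j) = 2 * k ∸ suc j

  lower-spec : ∀ {j} → 0 < j → j ≤ 2 * k → lower j + j ≡ 2 * k
  lower-spec {suc j} _ le = m∸n+n≡m le

  -- Position 4k = 2·(2k) gets label 0 again: the labeling is 4k-periodic.
  lower-last : lower (2 * k) ≡ 0
  lower-last = lower-self (2 * k) refl
    where
    lower-self : ∀ j → j ≡ 2 * k → lower j ≡ 0
    lower-self zero _ = refl
    lower-self (suc j) eq = m≤n⇒m∸n≡0 (≤-reflexive (sym eq))

  0<2k : 0 < 2 * k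
  0<2k = *-monoʳ-< 2 k>0

  4k≡2[2k] : 4 * k ≡ 2 * (2 * k)
  4k≡2[2k] = *-assoc 2 2 k

  4k≡2k+2k : 4 * k ≡ 2 * k + 2 * k
  4k≡2k+2k = trans 4k≡2[2k] (cong (2 * k +_) (+-identityʳ (2 * k)))

  2k<4k : 2 * k < 4 * k
  2k<4k = subst (2 * k <_) (sym 4k≡2k+2k) (m<m+n (2 * k) 0<2k)

  2[1+2k]≡2+4k : 2 * suc (2 * k) ≡ 2 + 4 * k
  2[1+2k]≡2+4k = trans (*-suc 2 (2 * k)) (cong (2 +_) (sym 4k≡2[2k]))

  lower-< : ∀ {j} → j < 2 * k → lower j < 2 * k
  lower-< {zero} _ = 0<2k
  lower-< {suc j} lt = subst (lower (suc j) <_) (lower-spec z<s (<⇒≤ lt)) (m<m+n _ z<s)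

  -- lower is injective on [0,2k): it vanishes only at 0, and lower j + j = 2k elsewhere.
  lower-injective : ∀ {j j'} → j < 2 * k → j' < 2 * k → lower j ≡ lower j' → j ≡ j'
  lower-injective {zero} {zero} _ _ _ = refl
  lower-injective {zero} {suc j'} _ lt' eq = contradiction eq (<⇒≢ (m<n⇒0<n∸m lt'))
  lower-injective {suc j} {zero} lt _ eq = contradiction (sym eq) (<⇒≢ (m<n⇒0<n∸m lt))
  lower-injective {suc j} {suc j'} lt lt' eq = +-cancelˡ-≡ (lower (suc j)) (suc j) (suc j') (begin
    lower (suc j) + suc j     ≡⟨ lower-spec z<s (<⇒≤ lt) ⟩
    2 * k                     ≡⟨ sym (lower-spec z<s (<⇒≤ lt')) ⟩
    lower (suc j') + suc j'   ≡⟨ cong (_+ suc j') (sym eq) ⟩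
    lower (suc j) + suc j'    ∎)
    where open ≡-Reasoning

  -- The jump by 2 in the odd labels that skips the forbidden length 2k+1.
  gap : ℕ → ℕ
  gap j with j <? k
  ... | yes _ = 0
  ... | no _ = 2

  gap-below : ∀ {j} → j < k → gap j ≡ 0
  gap-below {j} lt with j <? k
  ... | yes _ = refl
  ... | no ¬lt = contradiction lt ¬lt

  gap-above : ∀ {j} → k ≤ j → gap j ≡ 2
  gap-above {j} ge with j <? k
  ... | yes lt = contradiction ge (<⇒≱ lt)
  ... | no _ = refl

  gap-≤ : ∀ j → gap j ≤ 2
  gap-≤ j with j <? k
  ... | yes _ = z≤n
  ... | no _ = ≤-refl

  gap-mono : ∀ {j j'} → j ≤ j' → gap j ≤ gap j'
  gap-mono {j} {j'} le with j <? k | j' <? k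
  ... | yes _ | _ = z≤n
  ... | no _ | no _ = ≤-refl
  ... | no ¬lt | yes lt' = contradiction (≤-<-trans le lt') ¬lt

  upper : ℕ → ℕ
  upper j = gap j + (2 * k + j)

  upper-≥ : ∀ j → 2 * k ≤ upper j
  upper-≥ j = ≤-trans (m≤m+n (2 * k) j) (m≤n+m _ (gap j))

  upper-monotone : ∀ {j j'} → j < j' → upper j < upper j'
  upper-monotone lt = +-mono-≤-< (gap-mono (<⇒≤ lt)) (+-monoʳ-< (2 * k) lt)

  upper-injective : ∀ {j j'} → upper j ≡ upper j' → j ≡ j'
  upper-injective {j} {j'} eq with <-cmp j j'
  ... | tri< lt _ _ = contradiction eq (<⇒≢ (upper-monotone lt))
  ... | tri≈ _ j≡j' _ = j≡j'
  ... | tri> _ _ gt = contradiction (sym eq) (<⇒≢ (upper-monotone gt))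

  label : ℕ → ℕ
  label n with half n
  ... | (j , false) = lower j
  ... | (j , true) = upper j

  colour : ℕ → Bool
  colour n = proj₂ (half n)

  label-even : ∀ j → label (2 * j) ≡ lower j
  label-even j rewrite half-even j = refl

  label-odd : ∀ j → label (suc (2 * j)) ≡ upper j
  label-odd j rewrite half-odd j = refl

  label-odd-next : ∀ j → label (suc (suc (2 * j))) ≡ lower (suc j)
  label-odd-next j = trans (cong label (sym (*-suc 2 j))) (label-even (suc j))

  colour-even : ∀ j → colour (2 * j) ≡ false
  colour-even j = cong proj₂ (half-even j)

  colour-odd : ∀ j → colour (suc (2 * j)) ≡ true
  colour-odd j = cong proj₂ (half-odd j)

  label-period : label (4 * k) ≡ label 0
  label-period = trans (cong label 4k≡2[2k]) (trans (label-even (2 * k)) lower-last)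

  colour-period : colour (4 * k) ≡ colour 0
  colour-period = trans (cong colour 4k≡2[2k]) (colour-even (2 * k))

  -- For odd i, colour (suc i) reduces to the colour of the even vertex i − 1.
  colour-alternates : ∀ i → colour i ≢ colour (suc i)
  colour-alternates i with evenOdd i
  ... | even j = λ eq → contradiction (trans (sym (colour-even j)) (trans eq (colour-odd j))) λ ()
  ... | odd j = λ eq → contradiction (trans (sym (colour-even j)) (trans (sym eq) (colour-odd j))) λ ()

  edge-even : ∀ {j} → 0 < j → j ≤ 2 * k → edgeLength label (2 * j) ≡ gap j + 2 * j
  edge-even {j} j>0 j≤2k rewrite label-even j | label-odd j = dist-grow {lower j} (begin
    gap j + (2 * k + j)          ≡⟨ cong (λ s → gap j + (s + j)) (sym (lower-spec j>0 j≤2k)) ⟩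
    gap j + ((lower j + j) + j)  ≡⟨ regroup (gap j) (lower j) j ⟩
    lower j + (gap j + 2 * j)    ∎)
    where
    open ≡-Reasoning
    regroup : ∀ g a j → g + ((a + j) + j) ≡ a + (g + 2 * j)
    regroup = solve-∀

  edge-odd : ∀ {j} → suc j ≤ 2 * k → edgeLength label (suc (2 * j)) ≡ gap j + suc (2 * j)
  edge-odd {j} sj≤2k rewrite label-odd j | label-odd-next j = dist-shrink {upper j} {lower (suc j)} (begin
    gap j + (2 * k + j)                      ≡⟨ cong (λ s → gap j + (s + j)) (sym (lower-spec z<s sj≤2k)) ⟩
    gap j + ((lower (suc j) + suc j) + j)    ≡⟨ regroup (gap j) (lower (suc j)) j ⟩
    lower (suc j) + (gap j + suc (2 * j))    ∎)
    where
    open ≡-Reasoning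
    regroup : ∀ g a j → g + ((a + suc j) + j) ≡ a + (g + suc (2 * j))
    regroup = solve-∀

  first-edge : edgeLength label 0 ≡ 2 * k
  first-edge = trans (cong (_+ (2 * k + 0)) (gap-below k>0)) (+-identityʳ (2 * k))

  low-edge : ∀ {i} → 0 < i → i < 2 * k → edgeLength label i ≡ i
  low-edge {i} i>0 i<2k with evenOdd i
  low-edge {_} () _ | even zero
  ... | even (suc j) = let j<k = half-< {suc j} {k} i<2k in
    trans (edge-even z<s (<⇒≤ (<-≤-trans j<k (m≤m+n k _)))) (cong (_+ 2 * suc j) (gap-below j<k))
  ... | odd j = let j<k = odd-< {j} {k} i<2k in
    trans (edge-odd (≤-trans j<k (m≤m+n k _))) (cong (_+ suc (2 * j)) (gap-below j<k))

  high-edge : ∀ {i} → 2 * k ≤ i → i < 4 * k → edgeLength label i ≡ 2 + i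
  high-edge {i} 2k≤i i<4k with evenOdd i | subst (i <_) 4k≡2[2k] i<4k
  ... | even j | i<2[2k] =
    let k≤j = half-≤ {k} {j} 2k≤i in
    trans (edge-even (<-≤-trans k>0 k≤j) (<⇒≤ (half-< {j} {2 * k} i<2[2k]))) (cong (_+ 2 * j) (gap-above k≤j))
  ... | odd j | i<2[2k] =
    trans (edge-odd (odd-< {j} {2 * k} i<2[2k])) (cong (_+ suc (2 * j)) (gap-above (odd-≤ {k} {j} 2k≤i)))

  edge-allowed : ∀ {i} → i < 4 * k → Allowed 2 (2 * k) (edgeLength label i)
  edge-allowed {zero} _ rewrite first-edge =
    allowed₂ (<-trans (n<1+n _) (m<m+n _ z<s)) (<⇒≢ 0<2k ∘ sym) (<⇒≢ (n<1+n _))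
  edge-allowed {suc i} i<4k with suc i <? 2 * k
  ... | yes lt rewrite low-edge z<s lt =
    allowed₂ (<-trans lt (<-trans (n<1+n _) (m<m+n _ z<s))) (λ ()) (<⇒≢ (<-trans lt (n<1+n _)))
  ... | no ¬lt rewrite high-edge (≮⇒≥ ¬lt) i<4k =
    allowed₂ (subst (2 + suc i <_) (sym 2[1+2k]≡2+4k) (s≤s (s≤s i<4k)))
             (λ ()) (<⇒≢ (s≤s (s≤s (≮⇒≥ ¬lt))) ∘ sym)

  edge-onto : ∀ {t} → Allowed 2 (2 * k) t → ∃[ i ] (i < 4 * k × edgeLength label i ≡ t)
  edge-onto {t} adm@(t<2M , _) with allowed₂⁻ adm | <-cmp t (2 * k)
  ... | t≢0 , _ | tri< lt _ _ = t , <-trans lt 2k<4k , low-edge (n≢0⇒n>0 t≢0) lt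
  ... | _ | tri≈ _ eq _ = 0 , ≤-<-trans z≤n 2k<4k , trans first-edge (sym eq)
  ... | _ , t≢M | tri> _ _ gt = high-case t t<2M gt t≢M
    where
    high-case : ∀ t → t < 2 * suc (2 * k) → 2 * k < t → t ≢ suc (2 * k) → ∃[ i ] (i < 4 * k × edgeLength label i ≡ t)
    high-case zero _ () _
    high-case (suc zero) _ (s≤s 2k≤0) t≢M = contradiction (cong suc (sym (n≤0⇒n≡0 2k≤0))) t≢M
    high-case (suc (suc i)) t<2M (s≤s 2k≤1+i) t≢M with m≤n⇒m<n∨m≡n 2k≤1+i
    ... | inj₂ eq = contradiction (cong suc (sym eq)) t≢M
    ... | inj₁ 2k<1+i = i , i<4k , high-edge (≤-pred 2k<1+i) i<4k
      where
      i<4k : i < 4 * k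
      i<4k = ≤-pred (≤-pred (subst (suc (suc (suc i)) ≤_) 2[1+2k]≡2+4k t<2M))

  label-injective : ∀ {i i'} → i < 4 * k → i' < 4 * k → label i ≡ label i' → i ≡ i'
  label-injective {i} {i'} i<4k i'<4k eq
    with evenOdd i | evenOdd i' | subst (i <_) 4k≡2[2k] i<4k | subst (i' <_) 4k≡2[2k] i'<4k
  ... | even j | even j' | lt | lt' rewrite label-even j | label-even j' =
    cong (2 *_) (lower-injective (half-< {j} {2 * k} lt) (half-< {j'} {2 * k} lt') eq)
  ... | odd j | odd j' | _ | _ rewrite label-odd j | label-odd j' =
    cong (suc ∘ (2 *_)) (upper-injective eq)
  ... | even j | odd j' | lt | _ rewrite label-even j | label-odd j' =
    contradiction eq (<⇒≢ (<-≤-trans (lower-< (half-< {j} {2 * k} lt)) (upper-≥ j')))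
  ... | odd j | even j' | _ | lt' rewrite label-odd j | label-even j' =
    contradiction (sym eq) (<⇒≢ (<-≤-trans (lower-< (half-< {j'} {2 * k} lt')) (upper-≥ j)))

  label-range : ∀ {i} → i < 4 * k → label i < 2 * suc (2 * k)
  label-range {i} i<4k with evenOdd i | subst (i <_) 4k≡2[2k] i<4k
  ... | even j | lt rewrite label-even j =
    <-trans (lower-< (half-< {j} {2 * k} lt)) (subst (2 * k <_) (sym 2[1+2k]≡2+4k) (<-trans 2k<4k (m<n+m (4 * k) {2} z<s)))
  ... | odd j | lt rewrite label-odd j = subst (upper j <_) (sym 2[1+2k]≡2+4k)
    (+-mono-≤-< (gap-≤ j) (subst (2 * k + j <_) (sym 4k≡2k+2k) (+-monoʳ-< (2 * k) (odd-< {j} {2 * k} lt))))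

  label-separated : ∀ {i i'} → i < 4 * k → colour i ≡ false → colour i' ≡ true → label i < label i'
  label-separated {i} {i'} i<4k ci ci' with evenOdd i | evenOdd i'
  ... | odd j | _ = contradiction (trans (sym ci) (colour-odd j)) λ ()
  ... | even j | even j' = contradiction (trans (sym ci') (colour-even j')) λ ()
  ... | even j | odd j' rewrite label-even j | label-odd j' =
    <-≤-trans (lower-< (half-< {j} {2 * k} (subst (2 * j <_) 4k≡2[2k] i<4k))) (upper-≥ j')

theorem4p1 : ∀ (k : ℕ) → 1 ≤ k → ∃[ f ] IsDGracefulα 2 (Cycle (4 * k)) f
theorem4p1 k k≥1 =
  (λ x → label (toℕ x))
  , cycle-dGraceful {2} {2 * k} label 4k≡2[2k] label-period
      label-injective label-range edge-allowed edge-onto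
  , cycle-α label colour colour-period
      (λ {i} _ → colour-alternates i) (λ {i} {j} → label-separated {i} {j})
  where open Construction k k≥1
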